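{- Let $p=12$ and let $\mathcal{A}_1,\mathcal{A}_2,\dots$ be a sequence of $2$-element subsets of $\mathbb{N}$. For $n\ge0$ let $C_n$ be the set of cube-free words $w_1\cdots w_n$ with $w_i\in\mathcal{A}_i$ for all $i$, and for $t\in\Gamma$ let $C_n^t=\{w\in C_n:\Gamma(w)=t\}$. Then for all $n\in\mathbb{N}$ and $t\in\Gamma$, \[ |C_{n+1}^t|\ \ge\ \sum_{v\in C_n}\ \#\{c\in\mathcal{A}_{n+1}: vc\in\widetilde{\mathcal{C}}^{(p)},\ \Gamma(vc)=t\}\ -\ \sum_{i=p+1}^{n+1}|C_{n+1-i}^t|. \]
   Context: Words are finite sequences of letters from $\mathbb{N}$; $\varepsilon$ is the empty word. A cube is a word $uuu$ with $u$ nonempty; its period is $|u|$; a word is cube-free if it has no cube as a factor. $\widetilde{\mathcal{C}}^{(p)}$ is the set of words over $\mathbb{N}$ containing no factor $uuu$ with $1\le|u|\le p$. A minimal cube is a cube containing no other cube as a proper factor. A word is normalized if it is lexicographically smallest among all words obtained from it by applying a permutation of $\mathbb{N}$ letterwise. $\Gamma$ is the set of normalized proper prefixes (including $\varepsilon$) of minimal cubes of period at most $p$; for any word $w$, $\Gamma(w)$ is the longest element of $\Gamma$ equal to the image, under some permutation of $\mathbb{N}$ applied letterwise, of a suffix of $w$. -}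

module Defs where

open import Data.Nat using (ℕ; zero; suc; _+_; _∸_; _≤_)
open import Data.List using (List; []; _∷_; _++_; map; length; upTo; [_])
open import Data.Nat.ListAction using (sum)
open import Data.List.Membership.Propositional using (_∈_)
open import Data.List.Relation.Unary.Unique.Propositional using (Unique)
open import Data.List.Relation.Binary.Lex.NonStrict using (Lex-≤)
open import Data.Product using (Σ; ∃; ∃₂; _×_; _,_; proj₁; proj₂)
open import Data.Sum using (_⊎_)
open import Function.Bundles using (_↔_; _⇔_; Inverse)
open import Relation.Binary.PropositionalEquality using (_≡_; _≢_)
open import Relation.Nullary using (¬_)

Word : Set
Word = List ℕ

p : ℕ
p = 12

Factor : Word → Word → Set
Factor f w = ∃₂ λ x y → x ++ f ++ y ≡ w

ProperFactor : Word → Word → Set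
ProperFactor f w = Factor f w × f ≢ w

CubeWithPeriod : ℕ → Word → Set
CubeWithPeriod d c = Σ Word λ u → u ≢ [] × length u ≡ d × c ≡ u ++ u ++ u

IsCube : Word → Set
IsCube c = Σ Word λ u → u ≢ [] × c ≡ u ++ u ++ u

CubeFree : Word → Set
CubeFree w = ∀ u → u ≢ [] → ¬ Factor (u ++ u ++ u) w

CTilde : ℕ → Word → Set
CTilde q w = ∀ u → 1 ≤ length u → length u ≤ q → ¬ Factor (u ++ u ++ u) w

MinimalCube : Word → Set
MinimalCube c = IsCube c × (∀ f → ProperFactor f c → ¬ IsCube f)

_·_ : ℕ ↔ ℕ → Word → Word
π · w = map (Inverse.to π) w

_≤lex_ : Word → Word → Set
_≤lex_ = Lex-≤ _≡_ _≤_

Normalized : Word → Set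
Normalized w = ∀ (π : ℕ ↔ ℕ) → w ≤lex (π · w)

ProperPrefix : Word → Word → Set
ProperPrefix t c = Σ Word λ s → s ≢ [] × t ++ s ≡ c

InΓ : ℕ → Word → Set
InΓ q t = Normalized t ×
  (Σ Word λ c → MinimalCube c × (Σ ℕ λ d → d ≤ q × CubeWithPeriod d c) × ProperPrefix t c)

IsoToSuffix : Word → Word → Set
IsoToSuffix t w = Σ Word λ s → (Σ Word λ x → x ++ s ≡ w) × (Σ (ℕ ↔ ℕ) λ π → π · s ≡ t)

ΓIs : ℕ → Word → Word → Set
ΓIs q w t = InΓ q t × IsoToSuffix t w ×
  (∀ t' → InΓ q t' → IsoToSuffix t' w → length t' ≤ length t)

-- A sequence of 2-element subsets A_1, A_2, … given by pairs (A i = {proj₁, proj₂});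
-- the value at index 0 is unused.
Alphabets : Set
Alphabets = ℕ → ℕ × ℕ

_∈A_ : ℕ → ℕ × ℕ → Set
c ∈A a = c ≡ proj₁ a ⊎ c ≡ proj₂ a

data FitsFrom (A : Alphabets) : ℕ → Word → Set where
  []  : ∀ {i} → FitsFrom A i []
  _∷_ : ∀ {i c w} → c ∈A A i → FitsFrom A (suc i) w → FitsFrom A i (c ∷ w)

C : Alphabets → ℕ → Word → Set
C A n w = length w ≡ n × FitsFrom A 1 w × CubeFree w

Ct : Alphabets → Word → ℕ → Word → Set
Ct A t n w = C A n w × ΓIs p w t

Ext : Alphabets → ℕ → Word → Word → ℕ → Set
Ext A n t v c = c ∈A A (suc n) × CTilde p (v ++ [ c ]) × ΓIs p (v ++ [ c ]) t

-- A finite set given by a duplicate-free enumeration; its size is the list length.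
record Enum {X : Set} (P : X → Set) : Set where
  field
    list     : List X
    unique   : Unique list
    complete : ∀ x → (x ∈ list) ⇔ P x

size : ∀ {X : Set} {P : X → Set} → Enum P → ℕ
size E = length (Enum.list E)

-- Σ_{i=a}^{b} f i  (empty when b < a)
sumRange : ℕ → ℕ → (ℕ → ℕ) → ℕ
sumRange a b f = sum (map (λ k → f (a + k)) (upTo (suc b ∸ a)))

-- Let w = v c be counted on the left. Either w is cube-free, and then w ∈ C_{n+1}^t, or,
-- since v is cube-free and w ∈ C̃^(p), w = a u u u with |u| = i > p. In the second case
-- y = a u u is cube-free and Γ(y) = Γ(w) = t: a suffix isomorphic to an element of Γ has a
-- period at most p, so it cannot contain u u, for then u u would have periods d ≤ p and
-- |u|, hence (by a weak Fine–Wilf argument) a common period g ≤ d with 3g ≤ 2|u|, and so a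
-- cube of period at most p. Thus w is y followed by its own last i letters for some
-- y ∈ C_{n+1-i}^t, so the distinct words counted on the left all occur in the list made of
-- C_{n+1}^t and these images.

module Submission where

open import Defs
open import Data.Empty using (⊥-elim)
open import Data.List
  using (List; []; _∷_; _++_; _∷ʳ_; map; length; take; drop; concatMap; upTo; [_]; initLast; _∷ʳ′_)
open import Data.List.Properties
  using ( length-++; length-map; length-take; length-++-≤ˡ; length-++-≤ʳ; length-++-sucʳ; take++drop≡id
        ; ++-assoc; ++-identityʳ; ∷-injectiveʳ; ∷ʳ-injectiveˡ; ∷ʳ-injectiveʳ; map-cong; ≡-dec)
open import Data.List.Membership.Propositional using (_∈_; find)
open import Data.List.Membership.Propositional.Properties
  using (∈-∃++; ∈-++⁻; ∈-++⁺ˡ; ∈-++⁺ʳ; ∈-map⁺; ∈-map⁻; ∈-concat⁺′; ∈-concatMap⁻; ∈-upTo⁺)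
open import Data.List.Relation.Binary.Disjoint.Propositional using (Disjoint)
open import Data.List.Relation.Binary.Subset.Propositional using (_⊆_)
open import Data.List.Relation.Unary.All using (lookup)
open import Data.List.Relation.Unary.Any using (here; there)
open import Data.List.Relation.Unary.Unique.Propositional using (Unique; []; _∷_)
open import Data.List.Relation.Unary.Unique.Propositional.Properties using (++⁺; map⁺)
open import Data.Nat
  using (ℕ; zero; suc; _+_; _∸_; _*_; _≤_; _<_; _≤?_; _<?_; _≟_; z≤n; s≤s; s≤s⁻¹; >-nonZero)
open import Data.List.Membership.DecPropositional (≡-dec _≟_) using (_∈?_)
open import Data.Nat.Divisibility using (_∣_; divides; ∣-refl; ∣⇒≤; ∣m∣n⇒∣m+n)
open import Data.Nat.ListAction using (sum)
open import Data.Nat.Properties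
open import Data.Product using (∃-syntax; _×_; _,_; proj₁; proj₂)
open import Data.Sum using (inj₁; inj₂)
open import Function using (_∘_)
open import Function.Bundles using (_↔_; Equivalence; Injection)
open import Function.Properties.Inverse using (↔⇒↣)
open import Relation.Binary.Definitions using (tri<; tri≈; tri>)
open import Relation.Binary.PropositionalEquality hiding ([_])
open import Relation.Nullary using (¬_; yes; no)
open import Relation.Nullary.Decidable using (decidable-stable)

open ≡-Reasoning

-- Periods of words

-- Out-of-range positions read as 0; `HasPeriod` only inspects positions below the length.
_!_ : Word → ℕ → ℕ
[]      ! _     = 0
(x ∷ w) ! zero  = x
(x ∷ w) ! suc j = w ! j

HasPeriod : ℕ → Word → Set
HasPeriod d w = ∀ j → j + d < length w → w ! j ≡ w ! (j + d)

!-++ˡ : ∀ u w j → j < length u → (u ++ w) ! j ≡ u ! j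
!-++ˡ (x ∷ u) w zero    _         = refl
!-++ˡ (x ∷ u) w (suc j) (s≤s j<u) = !-++ˡ u w j j<u

!-++ʳ : ∀ u w j → (u ++ w) ! (length u + j) ≡ w ! j
!-++ʳ []      w j = refl
!-++ʳ (x ∷ u) w j = !-++ʳ u w j

!-map : ∀ (f : ℕ → ℕ) w j → j < length w → map f w ! j ≡ f (w ! j)
!-map f (x ∷ w) zero    _         = refl
!-map f (x ∷ w) (suc j) (s≤s j<w) = !-map f w j j<w

!-take : ∀ m w j → j < m → take m w ! j ≡ w ! j
!-take (suc m) []      j       _         = refl
!-take (suc m) (x ∷ w) zero    _         = refl
!-take (suc m) (x ∷ w) (suc j) (s≤s j<m) = !-take m w j j<m

!-ext : ∀ u w → length u ≡ length w → (∀ j → j < length u → u ! j ≡ w ! j) → u ≡ w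
!-ext []      []      _   _  = refl
!-ext (x ∷ u) (y ∷ w) |u| eq =
  cong₂ _∷_ (eq 0 (s≤s z≤n)) (!-ext u w (suc-injective |u|) (λ j j<u → eq (suc j) (s≤s j<u)))

HasPeriod-short : ∀ {d} w → length w ≤ d → HasPeriod d w
HasPeriod-short {d} w |w|≤d j j+d<w = ⊥-elim (<⇒≱ j+d<w (≤-trans |w|≤d (m≤n+m d j)))

HasPeriod-++⁻ˡ : ∀ d u w → HasPeriod d (u ++ w) → HasPeriod d u
HasPeriod-++⁻ˡ d u w P j j+d<u = begin
  u ! j              ≡⟨ !-++ˡ u w j (≤-<-trans (m≤m+n j d) j+d<u) ⟨
  (u ++ w) ! j       ≡⟨ P j (<-≤-trans j+d<u (length-++-≤ˡ u)) ⟩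
  (u ++ w) ! (j + d) ≡⟨ !-++ˡ u w (j + d) j+d<u ⟩
  u ! (j + d)        ∎

HasPeriod-++⁻ʳ : ∀ d u w → HasPeriod d (u ++ w) → HasPeriod d w
HasPeriod-++⁻ʳ d u w P j j+d<w = begin
  w ! j                           ≡⟨ !-++ʳ u w j ⟨
  (u ++ w) ! (length u + j)       ≡⟨ P (length u + j) bound ⟩
  (u ++ w) ! (length u + j + d)   ≡⟨ cong ((u ++ w) !_) (+-assoc (length u) j d) ⟩
  (u ++ w) ! (length u + (j + d)) ≡⟨ !-++ʳ u w (j + d) ⟩
  w ! (j + d)                     ∎
  where
  bound : length u + j + d < length (u ++ w)
  bound = subst₂ _<_ (sym (+-assoc (length u) j d)) (sym (length-++ u)) (+-monoʳ-< (length u) j+d<w)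

HasPeriod-map⁻ : ∀ d {f : ℕ → ℕ} → (∀ {x y} → f x ≡ f y → x ≡ y) →
  ∀ w → HasPeriod d (map f w) → HasPeriod d w
HasPeriod-map⁻ d {f} f-injective w P j j+d<w = f-injective (begin
  f (w ! j)         ≡⟨ !-map f w j (≤-<-trans (m≤m+n j d) j+d<w) ⟨
  map f w ! j       ≡⟨ P j (subst (j + d <_) (sym (length-map f w)) j+d<w) ⟩
  map f w ! (j + d) ≡⟨ !-map f w (j + d) j+d<w ⟩
  f (w ! (j + d))   ∎)

HasPeriod-prepend : ∀ u w → HasPeriod (length u) (u ++ w) → HasPeriod (length u) (u ++ u ++ w)
HasPeriod-prepend u w P j j+L<uuw with j <? length u
... | yes j<L = begin
  (u ++ u ++ w) ! j       ≡⟨ !-++ˡ u (u ++ w) j j<L ⟩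
  u ! j                   ≡⟨ !-++ˡ u w j j<L ⟨
  (u ++ w) ! j            ≡⟨ !-++ʳ u (u ++ w) j ⟨
  (u ++ u ++ w) ! (L + j) ≡⟨ cong ((u ++ u ++ w) !_) (+-comm L j) ⟩
  (u ++ u ++ w) ! (j + L) ∎
  where L = length u
... | no j≮L = begin
  (u ++ u ++ w) ! j              ≡⟨ cong ((u ++ u ++ w) !_) L+j′≡j ⟨
  (u ++ u ++ w) ! (L + j′)       ≡⟨ !-++ʳ u (u ++ w) j′ ⟩
  (u ++ w) ! j′                  ≡⟨ P j′ (+-cancelˡ-< L (j′ + L) (length (u ++ w)) bound) ⟩
  (u ++ w) ! (j′ + L)            ≡⟨ !-++ʳ u (u ++ w) (j′ + L) ⟨
  (u ++ u ++ w) ! (L + (j′ + L)) ≡⟨ cong ((u ++ u ++ w) !_) shift ⟩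
  (u ++ u ++ w) ! (j + L)        ∎
  where
  L = length u
  j′ = j ∸ L
  L+j′≡j : L + j′ ≡ j
  L+j′≡j = m+[n∸m]≡n (≮⇒≥ j≮L)
  shift : L + (j′ + L) ≡ j + L
  shift = trans (sym (+-assoc L j′ L)) (cong (_+ L) L+j′≡j)
  bound : L + (j′ + L) < L + length (u ++ w)
  bound = subst₂ _<_ (sym shift) (length-++ u) j+L<uuw

HasPeriod-cube : ∀ u → HasPeriod (length u) (u ++ u ++ u)
HasPeriod-cube u =
  subst (λ x → HasPeriod (length u) (u ++ u ++ x)) (++-identityʳ u)
        (HasPeriod-prepend u (u ++ []) (HasPeriod-prepend u [] too-short))
  where
  too-short : HasPeriod (length u) (u ++ [])
  too-short = HasPeriod-short (u ++ []) (≤-reflexive (trans (length-++ u) (+-identityʳ (length u))))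

HasPeriod-square : ∀ u → HasPeriod (length u) (u ++ u)
HasPeriod-square u =
  HasPeriod-++⁻ˡ (length u) (u ++ u) u (subst (HasPeriod (length u)) (sym (++-assoc u u u)) (HasPeriod-cube u))

HasPeriod-+⇒ : ∀ {a c} w → a + c + a ≤ length w → HasPeriod a w → HasPeriod (a + c) w → HasPeriod c w
HasPeriod-+⇒ {a} {c} w len Pa Pac j j+c<w with j + (a + c) <? length w
... | yes j+a+c<w = begin
  w ! j             ≡⟨ Pac j j+a+c<w ⟩
  w ! (j + (a + c)) ≡⟨ cong (w !_) reorder ⟨
  w ! (j + c + a)   ≡⟨ Pa (j + c) (subst (_< length w) (sym reorder) j+a+c<w) ⟨
  w ! (j + c)       ∎
  where
  reorder : j + c + a ≡ j + (a + c)
  reorder = trans (+-assoc j c a) (cong (j +_) (+-comm c a))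
... | no j+a+c≮w = begin
  w ! j              ≡⟨ cong (w !_) j′+a≡j ⟨
  w ! (j′ + a)       ≡⟨ Pa j′ (subst (_< length w) (sym j′+a≡j) j<w) ⟨
  w ! j′             ≡⟨ Pac j′ (subst (_< length w) (sym shift) j+c<w) ⟩
  w ! (j′ + (a + c)) ≡⟨ cong (w !_) shift ⟩
  w ! (j + c)        ∎
  where
  a≤j : a ≤ j
  a≤j = +-cancelʳ-≤ (a + c) a j
          (≤-trans (subst (_≤ length w) (+-comm (a + c) a) len) (≮⇒≥ j+a+c≮w))
  j′ = j ∸ a
  j′+a≡j : j′ + a ≡ j
  j′+a≡j = m∸n+n≡m a≤j
  shift : j′ + (a + c) ≡ j + c
  shift = trans (sym (+-assoc j′ a c)) (cong (_+ c) j′+a≡j)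
  j<w : j < length w
  j<w = ≤-<-trans (m≤m+n j c) j+c<w

CommonPeriod : ℕ → ℕ → Word → Set
CommonPeriod a b w = ∃[ g ] 1 ≤ g × g ∣ a × g ∣ b × HasPeriod g w

CommonPeriod-swap : ∀ {a b w} → CommonPeriod a b w → CommonPeriod b a w
CommonPeriod-swap (g , g≥1 , g∣a , g∣b , Pg) = g , g≥1 , g∣b , g∣a , Pg

-- A weak Fine–Wilf theorem: with |w| ≥ a + b (instead of a + b − gcd a b) the
-- subtractive Euclidean algorithm runs entirely inside w.
weakFineWilf : ∀ {a b} w → 1 ≤ a → 1 ≤ b → a + b ≤ length w →
  HasPeriod a w → HasPeriod b w → CommonPeriod a b w
weakFineWilf {a} {b} w = go (a + b) w ≤-refl
  where
  go : ∀ fuel {a b} w → a + b ≤ fuel → 1 ≤ a → 1 ≤ b → a + b ≤ length w →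
    HasPeriod a w → HasPeriod b w → CommonPeriod a b w
  descend : ∀ fuel {a b} w → a < b → a + b ≤ suc fuel → 1 ≤ a → a + b ≤ length w →
    HasPeriod a w → HasPeriod b w → CommonPeriod a b w

  go zero {suc a} w () _ _ _ _ _
  go (suc fuel) {a} {b} w fuel-ok a≥1 b≥1 len Pa Pb with <-cmp a b
  ... | tri≈ _ refl _ = a , a≥1 , ∣-refl , ∣-refl , Pa
  ... | tri< a<b _ _  = descend fuel w a<b fuel-ok a≥1 len Pa Pb
  ... | tri> _ _ b<a  = CommonPeriod-swap {b} {a} {w}
    (descend fuel w b<a (subst (_≤ suc fuel) (+-comm a b) fuel-ok) b≥1
       (subst (_≤ length w) (+-comm a b) len) Pb Pa)

  descend fuel {a} w a<b fuel-ok a≥1 len Pa Pb with m≤n⇒∃[o]m+o≡n (<⇒≤ a<b)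
  ... | c , refl =
    let g , g≥1 , g∣a , g∣c , Pg = go fuel w fuel′ a≥1 c≥1 len′ Pa Pc
    in  g , g≥1 , g∣a , ∣m∣n⇒∣m+n g∣a g∣c , Pg
    where
    c≥1 : 1 ≤ c
    c≥1 = +-cancelˡ-< a 0 c (subst (_< a + c) (sym (+-identityʳ a)) a<b)
    fuel′ : a + c ≤ fuel
    fuel′ = s≤s⁻¹ (≤-trans (+-monoˡ-≤ (a + c) a≥1) fuel-ok)
    len′ : a + c ≤ length w
    len′ = ≤-trans (m≤n+m (a + c) a) len
    Pc = HasPeriod-+⇒ w (subst (_≤ length w) (+-comm a (a + c)) len) Pa Pb

HasPeriod-block : ∀ z x → HasPeriod (length z) (z ++ x) → length z ≤ length x →
  x ≡ z ++ drop (length z) x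
HasPeriod-block z x P z≤x = begin
  x                                      ≡⟨ take++drop≡id L x ⟨
  take L x ++ drop L x                   ≡⟨ cong (_++ drop L x) take≡z ⟩
  z ++ drop L x                          ∎
  where
  L = length z
  |take| : length (take L x) ≡ L
  |take| = trans (length-take L x) (m≤n⇒m⊓n≡m z≤x)
  take≡z : take L x ≡ z
  take≡z = !-ext (take L x) z |take| λ j j<take → let j<L = subst (j <_) |take| j<take in begin
    take L x ! j       ≡⟨ !-take L x j j<L ⟩
    x ! j              ≡⟨ !-++ʳ z x j ⟨
    (z ++ x) ! (L + j) ≡⟨ cong ((z ++ x) !_) (+-comm L j) ⟩
    (z ++ x) ! (j + L) ≡⟨ P j (subst₂ _<_ (+-comm L j) (sym (length-++ z)) (+-monoʳ-< L (<-≤-trans j<L z≤x))) ⟨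
    (z ++ x) ! j       ≡⟨ !-++ˡ z x j j<L ⟩
    z ! j              ∎

cube-of-period : ∀ g w → HasPeriod g w → g + g + g ≤ length w →
  ∃[ z ] length z ≡ g × Factor (z ++ z ++ z) w
cube-of-period g w P len = z , |z| , [] , x₃ , sym w≡zzzx₃
  where
  z = take g w
  x₁ = drop g w
  |z| : length z ≡ g
  |z| = trans (length-take g w) (m≤n⇒m⊓n≡m (≤-trans (≤-trans (m≤m+n g g) (m≤m+n (g + g) g)) len))
  length-z++ : ∀ {x y} → x ≡ z ++ y → length x ≡ g + length y
  length-z++ refl = trans (length-++ z) (cong (_+ _) |z|)
  w≡zx₁ : w ≡ z ++ x₁
  w≡zx₁ = sym (take++drop≡id g w)
  P₁ : HasPeriod (length z) (z ++ x₁)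
  P₁ = subst₂ HasPeriod (sym |z|) w≡zx₁ P
  |x₁| : g + g ≤ length x₁
  |x₁| = +-cancelˡ-≤ g (g + g) (length x₁)
           (subst₂ _≤_ (+-assoc g g g) (length-z++ w≡zx₁) len)
  x₂ = drop (length z) x₁
  x₁≡zx₂ : x₁ ≡ z ++ x₂
  x₁≡zx₂ = HasPeriod-block z x₁ P₁ (subst (_≤ length x₁) (sym |z|) (≤-trans (m≤m+n g g) |x₁|))
  P₂ : HasPeriod (length z) (z ++ x₂)
  P₂ = subst (HasPeriod (length z)) x₁≡zx₂ (HasPeriod-++⁻ʳ (length z) z x₁ P₁)
  |x₂| : g ≤ length x₂
  |x₂| = +-cancelˡ-≤ g g (length x₂)
           (subst (g + g ≤_) (length-z++ x₁≡zx₂) |x₁|)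
  x₃ = drop (length z) x₂
  x₂≡zx₃ : x₂ ≡ z ++ x₃
  x₂≡zx₃ = HasPeriod-block z x₂ P₂ (subst (_≤ length x₂) (sym |z|) |x₂|)
  w≡zzzx₃ : w ≡ (z ++ z ++ z) ++ x₃
  w≡zzzx₃ = begin
    w                     ≡⟨ w≡zx₁ ⟩
    z ++ x₁               ≡⟨ cong (z ++_) (trans x₁≡zx₂ (cong (z ++_) x₂≡zx₃)) ⟩
    z ++ z ++ z ++ x₃     ≡⟨ cong (z ++_) (++-assoc z z x₃) ⟨
    z ++ (z ++ z) ++ x₃   ≡⟨ ++-assoc z (z ++ z) x₃ ⟨
    (z ++ z ++ z) ++ x₃   ∎

-- Cubes and the suffix Γ

Factor-trans : ∀ {f g h} → Factor f g → Factor g h → Factor f h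
Factor-trans {f} {g} {h} (x , y , x++f++y≡g) (a , b , a++g++b≡h) = a ++ x , y ++ b , (begin
  (a ++ x) ++ f ++ y ++ b   ≡⟨ ++-assoc a x (f ++ y ++ b) ⟩
  a ++ x ++ f ++ y ++ b     ≡⟨ cong (λ k → a ++ x ++ k) (++-assoc f y b) ⟨
  a ++ x ++ (f ++ y) ++ b   ≡⟨ cong (a ++_) (++-assoc x (f ++ y) b) ⟨
  a ++ (x ++ f ++ y) ++ b   ≡⟨ cong (λ k → a ++ k ++ b) x++f++y≡g ⟩
  a ++ g ++ b               ≡⟨ a++g++b≡h ⟩
  h                         ∎)

CTilde-Factor : ∀ {q f w} → Factor f w → CTilde q w → CTilde q f
CTilde-Factor f⊑w w-free u |u|≥1 |u|≤q u³⊑f = w-free u |u|≥1 |u|≤q (Factor-trans u³⊑f f⊑w)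

CubeFree-Factor : ∀ {f w} → Factor f w → CubeFree w → CubeFree f
CubeFree-Factor f⊑w w-free u u≢[] u³⊑f = w-free u u≢[] (Factor-trans u³⊑f f⊑w)

length-≢[] : ∀ (u : Word) → u ≢ [] → 1 ≤ length u
length-≢[] []      u≢[] = ⊥-elim (u≢[] refl)
length-≢[] (x ∷ u) _    = s≤s z≤n

∣∧<⇒+≤ : ∀ {g i} → g ∣ i → g < i → g + g ≤ i
∣∧<⇒+≤ {g} (divides zero          refl) ()
∣∧<⇒+≤ {g} (divides (suc zero)    refl) g<g = ⊥-elim (<-irrefl (sym (+-identityʳ g)) g<g)
∣∧<⇒+≤ {g} (divides (suc (suc k)) refl) _   =
  subst (g + g ≤_) (+-assoc g g (k * g)) (m≤m+n (g + g) (k * g))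

square-period⇒¬CTilde : ∀ {q d} u → q < length u → 1 ≤ d → d ≤ q →
  HasPeriod d (u ++ u) → ¬ CTilde q (u ++ u)
square-period⇒¬CTilde {q} {d} u q<u d≥1 d≤q Pd uu-free =
  let g , g≥1 , g∣d , g∣i , Pg = weakFineWilf (u ++ u) d≥1 i≥1 d+i≤ Pd (HasPeriod-square u)
      g≤d = ∣⇒≤ ⦃ >-nonZero d≥1 ⦄ g∣d
      g+g≤i = ∣∧<⇒+≤ g∣i (≤-<-trans g≤d d<i)
      z , |z|≡g , z³⊑uu = cube-of-period g (u ++ u) Pg
        (subst (g + g + g ≤_) (sym (length-++ u)) (+-mono-≤ g+g≤i (≤-trans g≤d (<⇒≤ d<i))))
  in uu-free z (subst (1 ≤_) (sym |z|≡g) g≥1) (subst (_≤ q) (sym |z|≡g) (≤-trans g≤d d≤q)) z³⊑uu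
  where
  i = length u
  d<i : d < i
  d<i = ≤-<-trans d≤q q<u
  i≥1 : 1 ≤ i
  i≥1 = ≤-trans (s≤s z≤n) q<u
  d+i≤ : d + i ≤ length (u ++ u)
  d+i≤ = subst (d + i ≤_) (sym (length-++ u)) (+-monoˡ-≤ i (<⇒≤ d<i))

InΓ⇒HasPeriod : ∀ {q t} → InΓ q t → ∃[ d ] 1 ≤ d × d ≤ q × HasPeriod d t
InΓ⇒HasPeriod {t = t} (_ , _ , _ , (_ , d≤q , z , z≢[] , refl , refl) , e , _ , t++e≡zzz) =
  length z , length-≢[] z z≢[] , d≤q ,
  HasPeriod-++⁻ˡ (length z) t e (subst (HasPeriod (length z)) (sym t++e≡zzz) (HasPeriod-cube z))

image-InΓ⇒HasPeriod : ∀ {q t} s (π : ℕ ↔ ℕ) → π · s ≡ t → InΓ q t →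
  ∃[ d ] 1 ≤ d × d ≤ q × HasPeriod d s
image-InΓ⇒HasPeriod s π π·s≡t t∈Γ =
  let d , d≥1 , d≤q , Pt = InΓ⇒HasPeriod t∈Γ
  in  d , d≥1 , d≤q ,
      HasPeriod-map⁻ d (Injection.injective (↔⇒↣ π)) s (subst (HasPeriod d) (sym π·s≡t) Pt)

++-shorter-suffix : ∀ (a b c d : Word) → a ++ b ≡ c ++ d → length b ≤ length d → ∃[ r ] r ++ b ≡ d
++-shorter-suffix a       b []      d eq    _   = a , eq
++-shorter-suffix []      b (x ∷ c) d refl  b≤d = ⊥-elim (<⇒≱ (s≤s (length-++-≤ʳ d {c})) b≤d)
++-shorter-suffix (y ∷ a) b (x ∷ c) d eq    b≤d = ++-shorter-suffix a b c d (∷-injectiveʳ eq) b≤d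

Γ-suffix-inside-square : ∀ {q t} X u {x s} (π : ℕ ↔ ℕ) → q < length u → CTilde q (u ++ u) → InΓ q t →
  x ++ s ≡ X ++ u ++ u → π · s ≡ t → ∃[ r ] r ++ s ≡ u ++ u
Γ-suffix-inside-square X u {x} {s} π q<u uu-free t∈Γ eq π·s≡t with length s ≤? length (u ++ u)
... | yes s≤uu = ++-shorter-suffix x s X (u ++ u) eq s≤uu
... | no  s≰uu =
  let r , r++uu≡s = ++-shorter-suffix X (u ++ u) x s (sym eq) (<⇒≤ (≰⇒> s≰uu))
      d , d≥1 , d≤q , Ps = image-InΓ⇒HasPeriod s π π·s≡t t∈Γ
      Puu = HasPeriod-++⁻ʳ d r (u ++ u) (subst (HasPeriod d) (sym r++uu≡s) Ps)
  in  ⊥-elim (square-period⇒¬CTilde u q<u d≥1 d≤q Puu uu-free)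

IsoToSuffix-square : ∀ {q t} X Y u → q < length u → CTilde q (u ++ u) → InΓ q t →
  IsoToSuffix t (X ++ u ++ u) → IsoToSuffix t (Y ++ u ++ u)
IsoToSuffix-square X Y u q<u uu-free t∈Γ (s , (x , x++s≡) , π , π·s≡t) =
  let r , r++s≡uu = Γ-suffix-inside-square X u π q<u uu-free t∈Γ x++s≡ π·s≡t
  in  s , (Y ++ r , trans (++-assoc Y r s) (cong (Y ++_) r++s≡uu)) , π , π·s≡t

ΓIs-cube⇒square : ∀ {q t} a u → q < length u → CTilde q (u ++ u) →
  ΓIs q (a ++ u ++ u ++ u) t → ΓIs q (a ++ u ++ u) t
ΓIs-cube⇒square {q} a u q<u uu-free (t∈Γ , t≅ , longest) =
  t∈Γ , shorten t∈Γ t≅ , λ t′ t′∈Γ t′≅ → longest t′ t′∈Γ (lengthen t′∈Γ t′≅)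
  where
  reassoc : a ++ u ++ u ++ u ≡ (a ++ u) ++ u ++ u
  reassoc = sym (++-assoc a u (u ++ u))
  shorten : ∀ {t′} → InΓ q t′ → IsoToSuffix t′ (a ++ u ++ u ++ u) → IsoToSuffix t′ (a ++ u ++ u)
  shorten t′∈Γ = IsoToSuffix-square (a ++ u) a u q<u uu-free t′∈Γ ∘ subst (IsoToSuffix _) reassoc
  lengthen : ∀ {t′} → InΓ q t′ → IsoToSuffix t′ (a ++ u ++ u) → IsoToSuffix t′ (a ++ u ++ u ++ u)
  lengthen t′∈Γ = subst (IsoToSuffix _) (sym reassoc) ∘ IsoToSuffix-square a (a ++ u) u q<u uu-free t′∈Γ

-- Counting with duplicate-free lists

Unique⇒length-≤ : ∀ {A : Set} {xs ys : List A} → Unique xs → xs ⊆ ys → length xs ≤ length ys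
Unique⇒length-≤ [] _ = z≤n
Unique⇒length-≤ {xs = x ∷ xs} (x∉xs ∷ xs!) xs⊆ys with ∈-∃++ (xs⊆ys (here refl))
... | ys₁ , ys₂ , refl =
  subst (suc (length xs) ≤_) (sym (length-++-sucʳ ys₁ x ys₂)) (s≤s (Unique⇒length-≤ xs! xs⊆ys₁ys₂))
  where
  xs⊆ys₁ys₂ : xs ⊆ ys₁ ++ ys₂
  xs⊆ys₁ys₂ {y} y∈xs with ∈-++⁻ ys₁ (xs⊆ys (there y∈xs))
  ... | inj₁ y∈ys₁         = ∈-++⁺ˡ y∈ys₁
  ... | inj₂ (here refl)   = ⊥-elim (lookup x∉xs y∈xs refl)
  ... | inj₂ (there y∈ys₂) = ∈-++⁺ʳ ys₁ y∈ys₂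

length-concatMap : ∀ {A B : Set} (f : A → List B) xs → length (concatMap f xs) ≡ sum (map (length ∘ f) xs)
length-concatMap f []       = refl
length-concatMap f (x ∷ xs) = trans (length-++ (f x)) (cong (length (f x) +_) (length-concatMap f xs))

Unique-concatMap : ∀ {A B : Set} {f : A → List B} {xs} → Unique xs → (∀ x → Unique (f x)) →
  (∀ {x y z} → z ∈ f x → z ∈ f y → x ≡ y) → Unique (concatMap f xs)
Unique-concatMap [] _ _ = []
Unique-concatMap {f = f} {x ∷ xs} (x∉xs ∷ xs!) f! f-disjoint =
  ++⁺ (f! x) (Unique-concatMap xs! f! f-disjoint) disjoint
  where
  disjoint : Disjoint (f x) (concatMap f xs)
  disjoint (z∈fx , z∈fxs) =
    let y , y∈xs , z∈fy = find (∈-concatMap⁻ f {xs = xs} z∈fxs)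
    in  lookup x∉xs y∈xs (f-disjoint z∈fx z∈fy)

-- Words of C_n

FitsFrom-∷ʳ : ∀ {A i} v {c} → FitsFrom A i v → c ∈A A (i + length v) → FitsFrom A i (v ∷ʳ c)
FitsFrom-∷ʳ {A} {i} []      {c} []          c∈A = subst (λ k → c ∈A A k) (+-identityʳ i) c∈A ∷ []
FitsFrom-∷ʳ {A} {i} (x ∷ v) {c} (x∈A ∷ fits) c∈A =
  x∈A ∷ FitsFrom-∷ʳ v fits (subst (λ k → c ∈A A k) (+-suc i (length v)) c∈A)

FitsFrom-++⁻ˡ : ∀ {A i} u {w} → FitsFrom A i (u ++ w) → FitsFrom A i u
FitsFrom-++⁻ˡ []      _            = []
FitsFrom-++⁻ˡ (x ∷ u) (x∈A ∷ fits) = x∈A ∷ FitsFrom-++⁻ˡ u fits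

cube-ends-∷ʳ : ∀ v {c} u → CubeFree v → u ≢ [] → Factor (u ++ u ++ u) (v ∷ʳ c) →
  ∃[ a ] a ++ u ++ u ++ u ≡ v ∷ʳ c
cube-ends-∷ʳ v {c} u v-free u≢[] (a , b , eq) with initLast b
... | []       = a , trans (cong (a ++_) (sym (++-identityʳ (u ++ u ++ u)))) eq
... | b ∷ʳ′ c′ = ⊥-elim (v-free u u≢[] (a , b , ∷ʳ-injectiveˡ (a ++ (u ++ u ++ u) ++ b) v (begin
  (a ++ (u ++ u ++ u) ++ b) ∷ʳ c′     ≡⟨ ++-assoc a _ [ c′ ] ⟩
  a ++ ((u ++ u ++ u) ++ b) ∷ʳ c′     ≡⟨ cong (a ++_) (++-assoc (u ++ u ++ u) b [ c′ ]) ⟩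
  a ++ (u ++ u ++ u) ++ b ∷ʳ c′       ≡⟨ eq ⟩
  v ∷ʳ c                              ∎)))

prefix-∷ʳ : ∀ y u v {c} → u ≢ [] → y ++ u ≡ v ∷ʳ c → Factor y v
prefix-∷ʳ y u v u≢[] eq with initLast u
... | []        = ⊥-elim (u≢[] refl)
... | u′ ∷ʳ′ c′ = [] , u′ , ∷ʳ-injectiveˡ (y ++ u′) v (trans (++-assoc y u′ [ c′ ]) eq)

drop-length-++ : ∀ (x z : Word) → drop (length x) (x ++ z) ≡ z
drop-length-++ []      z = refl
drop-length-++ (_ ∷ x) z = drop-length-++ x z

repeatLast : ℕ → Word → Word
repeatLast i y = y ++ drop (length y ∸ i) y

repeatLast-square : ∀ a u → repeatLast (length u) (a ++ u ++ u) ≡ a ++ u ++ u ++ u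
repeatLast-square a u = begin
  y ++ drop (length y ∸ length u) y ≡⟨ cong (λ k → y ++ drop k y) |y|∸|u| ⟩
  y ++ drop (length (a ++ u)) y     ≡⟨ cong (λ k → y ++ drop (length (a ++ u)) k) (++-assoc a u u) ⟨
  y ++ drop (length (a ++ u)) ((a ++ u) ++ u) ≡⟨ cong (y ++_) (drop-length-++ (a ++ u) u) ⟩
  y ++ u                            ≡⟨ ++-assoc a (u ++ u) u ⟩
  a ++ (u ++ u) ++ u                ≡⟨ cong (a ++_) (++-assoc u u u) ⟩
  a ++ u ++ u ++ u                  ∎
  where
  y = a ++ u ++ u
  |y|∸|u| : length y ∸ length u ≡ length (a ++ u)
  |y|∸|u| = trans (cong (λ k → length k ∸ length u) (sym (++-assoc a u u)))
                  (trans (cong (_∸ length u) (length-++ (a ++ u))) (m+n∸n≡m (length (a ++ u)) (length u)))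

module Counting (A : Alphabets) (n : ℕ) (t : Word)
  (E : ∀ m → Enum (Ct A t m)) (En : Enum (C A n)) (Ec : ∀ v → Enum (Ext A n t v)) where

  extensionsOf : Word → List Word
  extensionsOf v = map (v ∷ʳ_) (Enum.list (Ec v))

  extensions : List Word
  extensions = concatMap extensionsOf (Enum.list En)

  repeatLastOf : ℕ → List Word
  repeatLastOf k = map (repeatLast (p + 1 + k)) (Enum.list (E (n + 1 ∸ (p + 1 + k))))

  -- C_{n+1}^t followed by the words y·(last i letters of y) for y ∈ C_{n+1-i}^t, i = p + 1 + k.
  candidates : List Word
  candidates = Enum.list (E (suc n)) ++ concatMap repeatLastOf (upTo (suc (n + 1) ∸ (p + 1)))

  length-extensions : length extensions ≡ sum (map (λ v → size (Ec v)) (Enum.list En))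
  length-extensions = trans (length-concatMap extensionsOf (Enum.list En))
    (cong sum (map-cong (λ v → length-map (v ∷ʳ_) (Enum.list (Ec v))) (Enum.list En)))

  length-candidates : length candidates ≡
    size (E (suc n)) + sumRange (p + 1) (n + 1) (λ i → size (E (n + 1 ∸ i)))
  length-candidates = trans (length-++ (Enum.list (E (suc n)))) (cong (size (E (suc n)) +_)
    (trans (length-concatMap repeatLastOf ks) (cong sum (map-cong length-repeatLastOf ks))))
    where
    ks = upTo (suc (n + 1) ∸ (p + 1))
    length-repeatLastOf : ∀ k → length (repeatLastOf k) ≡ size (E (n + 1 ∸ (p + 1 + k)))
    length-repeatLastOf k = length-map (repeatLast (p + 1 + k)) (Enum.list (E (n + 1 ∸ (p + 1 + k))))

  Unique-extensions : Unique extensions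
  Unique-extensions = Unique-concatMap (Enum.unique En)
    (λ v → map⁺ (∷ʳ-injectiveʳ v v) (Enum.unique (Ec v)))
    (λ z∈x z∈y → let _ , _ , z≡xc = ∈-map⁻ _ z∈x
                     _ , _ , z≡yd = ∈-map⁻ _ z∈y
                 in  ∷ʳ-injectiveˡ _ _ (trans (sym z≡xc) z≡yd))

  repeatLast∈candidates : ∀ {i y} → p < i → i ≤ n + 1 → Ct A t (n + 1 ∸ i) y →
    repeatLast i y ∈ candidates
  repeatLast∈candidates {i} {y} p<i i≤n+1 y∈Ct =
    subst (λ j → repeatLast j y ∈ candidates) p+1+k≡i
      (∈-++⁺ʳ (Enum.list (E (suc n))) (∈-concat⁺′ y′∈ (∈-map⁺ repeatLastOf (∈-upTo⁺ k<))))
    where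
    k = i ∸ (p + 1)
    p+1+k≡i : p + 1 + k ≡ i
    p+1+k≡i = m+[n∸m]≡n p<i
    y′∈ : repeatLast (p + 1 + k) y ∈ repeatLastOf k
    y′∈ = ∈-map⁺ (repeatLast (p + 1 + k)) (Equivalence.from (Enum.complete (E (n + 1 ∸ (p + 1 + k))) y)
            (subst (λ j → Ct A t (n + 1 ∸ j) y) (sym p+1+k≡i) y∈Ct))
    k< : k < suc (n + 1) ∸ (p + 1)
    k< = ∸-monoˡ-< (s≤s i≤n+1) p<i

  module _ {v c} (v∈C : C A n v) (c∈Ext : Ext A n t v c) where

    private
      w = v ∷ʳ c
      v-fits = proj₁ (proj₂ v∈C)
      v-free = proj₂ (proj₂ v∈C)
      w-free≤p = proj₁ (proj₂ c∈Ext)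
      Γw≡t = proj₂ (proj₂ c∈Ext)

    length-extension : length w ≡ n + 1
    length-extension = trans (length-++ v) (cong (_+ 1) (proj₁ v∈C))

    extension-fits : FitsFrom A 1 w
    extension-fits =
      FitsFrom-∷ʳ v v-fits (subst (λ k → c ∈A A (suc k)) (sym (proj₁ v∈C)) (proj₁ c∈Ext))

    square-prefix∈Ct : ∀ a u → p < length u → a ++ u ++ u ++ u ≡ w →
      Ct A t (n + 1 ∸ length u) (a ++ u ++ u)
    square-prefix∈Ct a u p<u a++u³≡w = (|y| , y-fits , y-free) , Γy≡t
      where
      y = a ++ u ++ u
      y++u≡w : y ++ u ≡ w
      y++u≡w = trans (++-assoc a (u ++ u) u) (trans (cong (a ++_) (++-assoc u u u)) a++u³≡w)
      |y| : length y ≡ n + 1 ∸ length u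
      |y| = trans (sym (m+n∸n≡m (length y) (length u)))
                  (cong (_∸ length u) (trans (sym (length-++ y)) (trans (cong length y++u≡w) length-extension)))
      y-fits : FitsFrom A 1 y
      y-fits = FitsFrom-++⁻ˡ y (subst (FitsFrom A 1) (sym y++u≡w) extension-fits)
      y-free : CubeFree y
      y-free = CubeFree-Factor (prefix-∷ʳ y u v (λ { refl → <⇒≱ p<u z≤n }) y++u≡w) v-free
      uu-free : CTilde p (u ++ u)
      uu-free = CTilde-Factor (a , u , trans (cong (a ++_) (++-assoc u u u)) a++u³≡w) w-free≤p
      Γy≡t : ΓIs p y t
      Γy≡t = ΓIs-cube⇒square a u p<u uu-free (subst (λ x → ΓIs p x t) (sym a++u³≡w) Γw≡t)

    -- Cube-freeness of w is not known to be decidable, but membership in a list of words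
    -- is, so it suffices to refute w ∉ candidates.
    extension∈candidates : w ∈ candidates
    extension∈candidates = decidable-stable (w ∈? candidates)
      λ w∉ → w∉ (cube-free (λ u u≢[] u³⊑w → w∉ (has-cube u u≢[] u³⊑w)))
      where
      cube-free : CubeFree w → w ∈ candidates
      cube-free w-free = ∈-++⁺ˡ (Equivalence.from (Enum.complete (E (suc n)) w)
        ((trans length-extension (+-comm n 1) , extension-fits , w-free) , Γw≡t))
      has-cube : ∀ u → u ≢ [] → Factor (u ++ u ++ u) w → w ∈ candidates
      has-cube u u≢[] u³⊑w with length u ≤? p
      ... | yes |u|≤p = ⊥-elim (w-free≤p u (length-≢[] u u≢[]) |u|≤p u³⊑w)
      ... | no  |u|≰p =
        let a , a++u³≡w = cube-ends-∷ʳ v u v-free u≢[] u³⊑w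
            |u|≤n+1 = subst (length u ≤_) (trans (cong length a++u³≡w) length-extension)
                        (≤-trans (length-++-≤ˡ u) (length-++-≤ʳ (u ++ u ++ u) {a}))
            p<u = ≰⇒> |u|≰p
        in  subst (_∈ candidates) (trans (repeatLast-square a u) a++u³≡w)
              (repeatLast∈candidates p<u |u|≤n+1 (square-prefix∈Ct a u p<u a++u³≡w))

  extensions⊆candidates : extensions ⊆ candidates
  extensions⊆candidates z∈ =
    let v , v∈En , z∈v = find (∈-concatMap⁻ extensionsOf {xs = Enum.list En} z∈)
        c , c∈Ec , z≡vc = ∈-map⁻ (v ∷ʳ_) z∈v
    in  subst (_∈ candidates) (sym z≡vc)
          (extension∈candidates (Equivalence.to (Enum.complete En v) v∈En)
                                (Equivalence.to (Enum.complete (Ec v) c) c∈Ec))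

lemma6 : (A : Alphabets) → (∀ i → 1 ≤ i → proj₁ (A i) ≢ proj₂ (A i)) →
    (n : ℕ) (t : Word) → InΓ p t →
    (E : ∀ m → Enum (Ct A t m)) (En : Enum (C A n)) (Ec : ∀ v → Enum (Ext A n t v)) →
    sum (map (λ v → size (Ec v)) (Enum.list En))
      ≤ size (E (suc n)) + sumRange (p + 1) (n + 1) (λ i → size (E (n + 1 ∸ i)))
lemma6 A _ n t _ E En Ec =
  subst₂ _≤_ length-extensions length-candidates (Unique⇒length-≤ Unique-extensions extensions⊆candidates)
  where open Counting A n t E En Ec
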